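{- For every integer $n\ge 1$, $\mathrm{BQP}_n\le_A \mathrm{QLOP}_{2n}$.
   Context: The Boolean quadratic polytope $\mathrm{BQP}_n$ is the convex hull of the set of vectors $x=(x_{ij})_{1\le i\le j\le n}\in\{0,1\}^{n(n+1)/2}$ satisfying $x_{ij}=x_{ii}x_{jj}$ for all $1\le i<j\le n$. For $m\ge 2$, the quadratic linear ordering polytope $\mathrm{QLOP}_m$ is defined as follows. Consider variables $y_{ij}$ for $1\le i<j\le m$ and variables $z_{ijkl}$ for $(i,j,k,l)$ in $I=\{(i,j,k,l): i<j,\ k<l,\ (i,j)\prec(k,l)\}$, where $(i,j)\prec(k,l)$ means $i<k$, or $i=k$ and $j<l$. $\mathrm{QLOP}_m$ is the convex hull of all $0/1$ vectors $(y,z)$ such that $0\le y_{ij}+y_{jk}-y_{ik}\le 1$ for all $1\le i<j<k\le m$ and $z_{ijkl}=y_{ij}y_{kl}$ for all $(i,j,k,l)\in I$. (Equivalently, $y$ ranges over characteristic vectors of linear orderings of $\{1,\dots,m\}$, with $y_{ij}=1$ iff $i$ precedes $j$.) For polytopes $p,q$, $p\le_A q$ means that $p$ is affinely equivalent (there is an affine bijection between their affine hulls mapping one onto the other) to $q$ or to a face of $q$.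
   Formalization: The polytopes $\mathrm{BQP}_n$ and $\mathrm{QLOP}_{2n}$ consist of points with rational coordinates, and the affine equivalence and the functionals defining faces are taken over ℚ. -}

module Defs where

open import Level using (Level; suc; _⊔_)
open import Data.Bool using (Bool; true; false; T; _∧_; _∨_)
open import Data.Nat using (ℕ; zero; _≡ᵇ_; _<ᵇ_; _≤ᵇ_)
open import Data.Fin using (Fin; toℕ)
import Data.Fin as F
open import Data.Product using (Σ; ∃; _×_; _,_; proj₁; proj₂)
open import Data.Sum using (_⊎_)
open import Data.Rational using (ℚ; 0ℚ; 1ℚ; _+_; _*_; _-_; _≤_)
open import Relation.Binary.PropositionalEquality using (_≡_)

Point : Set → Set
Point I = I → ℚ

_≈ₚ_ : {I : Set} → Point I → Point I → Set
x ≈ₚ y = ∀ i → x i ≡ y i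

sumℚ : (k : ℕ) → (Fin k → ℚ) → ℚ
sumℚ zero    f = 0ℚ
sumℚ (ℕ.suc k) f = f F.zero + sumℚ k (λ t → f (F.suc t))
  where import Data.Nat as ℕ

comb : {I : Set} (k : ℕ) → (Fin k → ℚ) → (Fin k → Point I) → Point I
comb k c p i = sumℚ k (λ t → c t * p t i)

conv : {I : Set} → (Point I → Set) → Point I → Set
conv {I} S x = Σ ℕ λ k → Σ (Fin k → ℚ) λ c → Σ (Fin k → Point I) λ p →
  (∀ t → S (p t)) × (∀ t → 0ℚ ≤ c t) × (sumℚ k c ≡ 1ℚ) × (x ≈ₚ comb k c p)

aff : {I : Set} → (Point I → Set) → Point I → Set
aff {I} S x = Σ ℕ λ k → Σ (Fin k → ℚ) λ c → Σ (Fin k → Point I) λ p →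
  (∀ t → S (p t)) × (sumℚ k c ≡ 1ℚ) × (x ≈ₚ comb k c p)

IsAffineMap : {I J : Set} → (Point I → Point J) → Set
IsAffineMap {I} f = ∀ (k : ℕ) (c : Fin k → ℚ) (p : Fin k → Point I) →
  sumℚ k c ≡ 1ℚ → f (comb k c p) ≈ₚ comb k c (λ t → f (p t))

IsAffineFunctional : {I : Set} → (Point I → ℚ) → Set
IsAffineFunctional {I} g = ∀ (k : ℕ) (c : Fin k → ℚ) (p : Fin k → Point I) →
  sumℚ k c ≡ 1ℚ → g (comb k c p) ≡ sumℚ k (λ t → c t * g (p t))

-- P (⊆ ℚ^I) and Q (⊆ ℚ^J) are affinely equivalent: an affine map that is
-- injective on aff P and maps P onto Q (hence aff P bijectively onto aff Q).
AffEquiv : {I J : Set} → (Point I → Set) → (Point J → Set) → Set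
AffEquiv {I} {J} P Q = Σ (Point I → Point J) λ f →
  IsAffineMap f ×
  (∀ x y → aff P x → aff P y → f x ≈ₚ f y → x ≈ₚ y) ×
  (∀ x → P x → Q (f x)) ×
  (∀ y → Q y → Σ (Point I) λ x → P x × (f x ≈ₚ y))

faceBy : {J : Set} → (Point J → Set) → (Point J → ℚ) → Point J → Set
faceBy Q g x = Q x × (g x ≡ 0ℚ)

IsValid : {J : Set} → (Point J → Set) → (Point J → ℚ) → Set
IsValid Q g = ∀ x → Q x → g x ≤ 0ℚ

_≤A_ : {I J : Set} → (Point I → Set) → (Point J → Set) → Set
_≤A_ {I} {J} P Q = AffEquiv P Q ⊎
  Σ (Point J → ℚ) λ g → IsAffineFunctional g × IsValid Q g × AffEquiv P (faceBy Q g)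

IsBit : ℚ → Set
IsBit q = (q ≡ 0ℚ) ⊎ (q ≡ 1ℚ)

-- BQP_n : coordinates x_ij, 1 ≤ i ≤ j ≤ n  (here 0-based Fin n)
BQPIdx : ℕ → Set
BQPIdx n = Σ (Fin n) λ i → Σ (Fin n) λ j → T (toℕ i ≤ᵇ toℕ j)

BQPVert : (n : ℕ) → Point (BQPIdx n) → Set
BQPVert n x =
  (∀ a → IsBit (x a)) ×
  (∀ (i j : Fin n) → T (toℕ i <ᵇ toℕ j) →
     (le : T (toℕ i ≤ᵇ toℕ j)) (ii : T (toℕ i ≤ᵇ toℕ i)) (jj : T (toℕ j ≤ᵇ toℕ j)) →
     x (i , j , le) ≡ x (i , i , ii) * x (j , j , jj))

BQP : (n : ℕ) → Point (BQPIdx n) → Set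
BQP n = conv (BQPVert n)

-- QLOP_m : y_ij (i < j) and z_ijkl ((i,j) ≺ (k,l))
YIdx : ℕ → Set
YIdx m = Σ (Fin m) λ i → Σ (Fin m) λ j → T (toℕ i <ᵇ toℕ j)

_≺ᵇ_ : {m : ℕ} → YIdx m → YIdx m → Bool
(i , j , _) ≺ᵇ (k , l , _) =
  (toℕ i <ᵇ toℕ k) ∨ ((toℕ i ≡ᵇ toℕ k) ∧ (toℕ j <ᵇ toℕ l))

ZIdx : ℕ → Set
ZIdx m = Σ (YIdx m) λ a → Σ (YIdx m) λ b → T (a ≺ᵇ b)

QLOPIdx : ℕ → Set
QLOPIdx m = YIdx m ⊎ ZIdx m

QLOPVert : (m : ℕ) → Point (QLOPIdx m) → Set
QLOPVert m v =
  (∀ a → IsBit (v a)) ×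
  (∀ (i j k : Fin m) (p : T (toℕ i <ᵇ toℕ j)) (q : T (toℕ j <ᵇ toℕ k))
     (r : T (toℕ i <ᵇ toℕ k)) →
     (0ℚ ≤ (y (i , j , p) + y (j , k , q)) - y (i , k , r)) ×
     ((y (i , j , p) + y (j , k , q)) - y (i , k , r) ≤ 1ℚ)) ×
  (∀ (a b : YIdx m) (s : T (a ≺ᵇ b)) → v (Data.Sum.inj₂ (a , b , s)) ≡ y a * y b)
  where
  import Data.Sum
  y : YIdx m → ℚ
  y a = v (Data.Sum.inj₁ a)

QLOP : (m : ℕ) → Point (QLOPIdx m) → Set
QLOP m = conv (QLOPVert m)

-- Split {0, …, 2n−1} into the blocks {2i, 2i+1}. Summing y_ab − 1 over the pairs a < b lying in
-- different blocks gives an affine functional that is ≤ 0 on QLOP_{2n}; its zero set is the face of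
-- orderings that put block i before block j whenever i < j. Such an ordering is determined by the
-- order inside each block, i.e. by the values x_ii := y_{2i,2i+1}, and on the face every coordinate
-- is 1, some x_ii, or x_ij := z_{(2i,2i+1),(2j,2j+1)} = x_ii x_jj (a product z with a factor y_ab = 1
-- equals its other factor). So filling the coordinates of QLOP_{2n} from x and the constant 1 maps
-- BQP_n affinely and injectively onto that face, with inverse the restriction to these coordinates.

module Submission where

open import Data.Bool using (T; _∨_; _∧_)
open import Data.Bool.Properties using (T-∨; T-∧; T-irrelevant)
open import Data.Empty using (⊥; ⊥-elim)
open import Data.Fin using (Fin; toℕ; fromℕ<; _≟_)
import Data.Fin as Fin
open import Data.Maybe using (Maybe; just; nothing; maybe′)
open import Data.Nat using (ℕ; zero; suc; _<ᵇ_; _≡ᵇ_)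
open import Data.Product using (Σ; _×_; _,_; proj₁; proj₂)
open import Data.Sum using (_⊎_; inj₁; inj₂)
open import Function using (_∘_)
open import Function.Bundles using (Equivalence)
open import Relation.Binary.PropositionalEquality
open import Relation.Nullary using (¬_; yes; no)
open import Relation.Nullary.Decidable using (T?; from-yes)

open import Defs

module FiniteSums where

  open import Data.Rational using (ℚ; 0ℚ; 1ℚ; _+_; _*_; _≤_; _≤?_)
  open import Data.Rational.Properties
    using (≤-refl; ≤-trans; ≤-antisym; ≤-reflexive; ≰⇒>; <⇒≢; +-mono-≤; +-mono-<-≤; +-comm;
           +-identityˡ; *-zeroʳ; *-identityʳ)
  open import Data.Rational.Solver using (module +-*-Solver)
  open +-*-Solver

  sumℚ-cong : ∀ k {f h : Fin k → ℚ} → (∀ t → f t ≡ h t) → sumℚ k f ≡ sumℚ k h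
  sumℚ-cong zero    f≡h = refl
  sumℚ-cong (suc k) f≡h = cong₂ _+_ (f≡h Fin.zero) (sumℚ-cong k (λ t → f≡h (Fin.suc t)))

  sumℚ-0 : ∀ k → sumℚ k (λ _ → 0ℚ) ≡ 0ℚ
  sumℚ-0 zero    = refl
  sumℚ-0 (suc k) = trans (+-identityˡ _) (sumℚ-0 k)

  sumℚ-+ : ∀ k (f h : Fin k → ℚ) → sumℚ k (λ t → f t + h t) ≡ sumℚ k f + sumℚ k h
  sumℚ-+ zero    f h = refl
  sumℚ-+ (suc k) f h = begin
    (f₀ + h₀) + sumℚ k (λ t → f (Fin.suc t) + h (Fin.suc t))
      ≡⟨ cong ((f₀ + h₀) +_) (sumℚ-+ k _ _) ⟩
    (f₀ + h₀) + (F + H)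
      ≡⟨ solve 4 (λ a b c d → (a :+ b) :+ (c :+ d) := (a :+ c) :+ (b :+ d)) refl f₀ h₀ F H ⟩
    (f₀ + F) + (h₀ + H) ∎
    where
    open ≡-Reasoning
    f₀ h₀ F H : ℚ
    f₀ = f Fin.zero
    h₀ = h Fin.zero
    F = sumℚ k (λ t → f (Fin.suc t))
    H = sumℚ k (λ t → h (Fin.suc t))

  sumℚ-*ˡ : ∀ k c (f : Fin k → ℚ) → sumℚ k (λ t → c * f t) ≡ c * sumℚ k f
  sumℚ-*ˡ zero    c f = sym (*-zeroʳ c)
  sumℚ-*ˡ (suc k) c f = begin
    c * f Fin.zero + sumℚ k (λ t → c * f (Fin.suc t))
      ≡⟨ cong (c * f Fin.zero +_) (sumℚ-*ˡ k c _) ⟩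
    c * f Fin.zero + c * F
      ≡⟨ solve 3 (λ c a b → c :* a :+ c :* b := c :* (a :+ b)) refl c (f Fin.zero) F ⟩
    c * (f Fin.zero + F) ∎
    where
    open ≡-Reasoning
    F = sumℚ k (λ t → f (Fin.suc t))

  sumℚ-swap : ∀ k l (h : Fin k → Fin l → ℚ) →
              sumℚ k (λ a → sumℚ l (h a)) ≡ sumℚ l (λ b → sumℚ k (λ a → h a b))
  sumℚ-swap zero    l h = sym (sumℚ-0 l)
  sumℚ-swap (suc k) l h = begin
    sumℚ l (h Fin.zero) + sumℚ k (λ a → sumℚ l (h (Fin.suc a)))
      ≡⟨ cong (sumℚ l (h Fin.zero) +_) (sumℚ-swap k l (λ a → h (Fin.suc a))) ⟩
    sumℚ l (h Fin.zero) + sumℚ l (λ b → sumℚ k (λ a → h (Fin.suc a) b))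
      ≡⟨ sumℚ-+ l (h Fin.zero) _ ⟨
    sumℚ l (λ b → sumℚ (suc k) (λ a → h a b)) ∎
    where
    open ≡-Reasoning

  sumℚ-weights-+ : ∀ k {c : Fin k → ℚ} → sumℚ k c ≡ 1ℚ → ∀ (f : Fin k → ℚ) β →
                    sumℚ k (λ t → c t * (f t + β)) ≡ sumℚ k (λ t → c t * f t) + β
  sumℚ-weights-+ k {c} Σc≡1 f β = begin
    sumℚ k (λ t → c t * (f t + β))
      ≡⟨ sumℚ-cong k (λ t → solve 3 (λ c f β → c :* (f :+ β) := c :* f :+ β :* c) refl
                                    (c t) (f t) β) ⟩
    sumℚ k (λ t → c t * f t + β * c t)
      ≡⟨ sumℚ-+ k _ _ ⟩
    sumℚ k (λ t → c t * f t) + sumℚ k (λ t → β * c t)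
      ≡⟨ cong (sumℚ k (λ t → c t * f t) +_)
              (trans (sumℚ-*ˡ k β c) (trans (cong (β *_) Σc≡1) (*-identityʳ β))) ⟩
    sumℚ k (λ t → c t * f t) + β ∎
    where open ≡-Reasoning

  sumℚ-mono-≤ : ∀ k {f h : Fin k → ℚ} → (∀ t → f t ≤ h t) → sumℚ k f ≤ sumℚ k h
  sumℚ-mono-≤ zero    f≤h = ≤-refl
  sumℚ-mono-≤ (suc k) f≤h = +-mono-≤ (f≤h Fin.zero) (sumℚ-mono-≤ k (λ t → f≤h (Fin.suc t)))

  sumℚ-nonpos : ∀ k {f : Fin k → ℚ} → (∀ t → f t ≤ 0ℚ) → sumℚ k f ≤ 0ℚ
  sumℚ-nonpos k f≤0 = ≤-trans (sumℚ-mono-≤ k f≤0) (≤-reflexive (sumℚ-0 k))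

  +-mono-≤-≡⇒≡ˡ : ∀ {p q r s} → p ≤ q → r ≤ s → p + r ≡ q + s → p ≡ q
  +-mono-≤-≡⇒≡ˡ {p} {q} p≤q r≤s p+r≡q+s with q ≤? p
  ... | yes q≤p = ≤-antisym p≤q q≤p
  ... | no  q≰p = ⊥-elim (<⇒≢ (+-mono-<-≤ (≰⇒> q≰p) r≤s) p+r≡q+s)

  sumℚ-mono-≤-≡⇒≡ : ∀ k {f h : Fin k → ℚ} → (∀ t → f t ≤ h t) →
                    sumℚ k f ≡ sumℚ k h → ∀ t → f t ≡ h t
  sumℚ-mono-≤-≡⇒≡ (suc k) f≤h Σf≡Σh Fin.zero =
    +-mono-≤-≡⇒≡ˡ (f≤h Fin.zero) (sumℚ-mono-≤ k (λ t → f≤h (Fin.suc t))) Σf≡Σh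
  sumℚ-mono-≤-≡⇒≡ (suc k) {f} {h} f≤h Σf≡Σh (Fin.suc t) =
    sumℚ-mono-≤-≡⇒≡ k (λ t → f≤h (Fin.suc t)) tails≡ t
    where
    tails≡ : sumℚ k (λ t → f (Fin.suc t)) ≡ sumℚ k (λ t → h (Fin.suc t))
    tails≡ = +-mono-≤-≡⇒≡ˡ (sumℚ-mono-≤ k (λ t → f≤h (Fin.suc t))) (f≤h Fin.zero)
               (trans (+-comm _ (f Fin.zero)) (trans Σf≡Σh (+-comm (h Fin.zero) _)))

  sumℚ-nonpos-≡0 : ∀ k {f : Fin k → ℚ} → (∀ t → f t ≤ 0ℚ) → sumℚ k f ≡ 0ℚ → ∀ t → f t ≡ 0ℚ
  sumℚ-nonpos-≡0 k f≤0 Σf≡0 = sumℚ-mono-≤-≡⇒≡ k f≤0 (trans Σf≡0 (sym (sumℚ-0 k)))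

open FiniteSums

module ConvexCombinations where

  open import Data.Rational using (ℚ; 0ℚ; 1ℚ; _+_; _*_; _-_; -_; _≤_; _≤?_; nonNegative)
  open import Data.Rational.Properties
    using (≤-refl; ≤-trans; ≤-reflexive; *-monoˡ-≤-nonNeg; *-zeroˡ; *-zeroʳ; *-identityʳ; nonNegative⁻¹;
           module ≤-Reasoning)
  open import Data.Rational.Solver using (module +-*-Solver)
  open +-*-Solver

  0-isAffineFunctional : ∀ {I : Set} → IsAffineFunctional {I} (λ _ → 0ℚ)
  0-isAffineFunctional k c p _ =
    sym (trans (sumℚ-cong k (λ t → *-zeroʳ (c t))) (sumℚ-0 k))

  coordinate-+-isAffineFunctional : ∀ {I : Set} (e : I) β → IsAffineFunctional (λ v → v e + β)
  coordinate-+-isAffineFunctional e β k c p Σc≡1 =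
    sym (sumℚ-weights-+ k Σc≡1 (λ t → p t e) β)

  sumℚ-isAffineFunctional : ∀ {I : Set} m {h : Fin m → Point I → ℚ} →
                            (∀ a → IsAffineFunctional (h a)) →
                            IsAffineFunctional (λ v → sumℚ m (λ a → h a v))
  sumℚ-isAffineFunctional m {h} h-aff k c p Σc≡1 = begin
    sumℚ m (λ a → h a (comb k c p))
      ≡⟨ sumℚ-cong m (λ a → h-aff a k c p Σc≡1) ⟩
    sumℚ m (λ a → sumℚ k (λ t → c t * h a (p t)))
      ≡⟨ sumℚ-swap m k _ ⟩
    sumℚ k (λ t → sumℚ m (λ a → c t * h a (p t)))
      ≡⟨ sumℚ-cong k (λ t → sumℚ-*ˡ m (c t) _) ⟩
    sumℚ k (λ t → c t * sumℚ m (λ a → h a (p t))) ∎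
    where open ≡-Reasoning

  bit-range : ∀ {u} → IsBit u → (0ℚ ≤ u) × (u ≤ 1ℚ)
  bit-range (inj₁ refl) = ≤-refl , nonNegative⁻¹ 1ℚ
  bit-range (inj₂ refl) = nonNegative⁻¹ 1ℚ , ≤-refl

  bit-idem : ∀ {u} → IsBit u → u ≡ u * u
  bit-idem (inj₁ refl) = refl
  bit-idem (inj₂ refl) = refl

  c*[bit-1]≤0 : ∀ {c u} → 0ℚ ≤ c → IsBit u → c * (u - 1ℚ) ≤ 0ℚ
  c*[bit-1]≤0 {c} 0≤c (inj₁ refl) =
    ≤-trans (*-monoˡ-≤-nonNeg c {{nonNegative 0≤c}} (from-yes (- 1ℚ ≤? 0ℚ))) (≤-reflexive (*-zeroʳ c))
  c*[bit-1]≤0 {c} 0≤c (inj₂ refl) = ≤-reflexive (*-zeroʳ c)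

  c*[u-1]≡0⇒c*[w*u]≡c*w : ∀ c {u} w → IsBit u → c * (u - 1ℚ) ≡ 0ℚ → c * (w * u) ≡ c * w
  c*[u-1]≡0⇒c*[w*u]≡c*w c w (inj₁ refl) c*-1≡0 =
    subst (λ c → c * (w * 0ℚ) ≡ c * w) (sym c≡0) (trans (*-zeroˡ (w * 0ℚ)) (sym (*-zeroˡ w)))
    where
    c≡0 : c ≡ 0ℚ
    c≡0 = trans (solve 1 (λ c → c := :- (c :* con (- 1ℚ))) refl c) (cong -_ c*-1≡0)
  c*[u-1]≡0⇒c*[w*u]≡c*w c w (inj₂ refl) _ = cong (c *_) (*-identityʳ w)

  module _ {I : Set} {S : Point I → Set} where

    conv-coordinate-≤1 : ∀ e → (∀ s → S s → IsBit (s e)) → ∀ {y} → conv S y → y e ≤ 1ℚ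
    conv-coordinate-≤1 e bits (k , c , v , v∈S , 0≤c , Σc≡1 , y≈) = begin
      _                          ≡⟨ y≈ e ⟩
      sumℚ k (λ t → c t * v t e) ≤⟨ sumℚ-mono-≤ k (λ t → weighted≤ (0≤c t) (bits _ (v∈S t))) ⟩
      sumℚ k c                   ≡⟨ Σc≡1 ⟩
      1ℚ                         ∎
      where
      open ≤-Reasoning
      weighted≤ : ∀ {c u} → 0ℚ ≤ c → IsBit u → c * u ≤ c
      weighted≤ {c} 0≤c u-bit = ≤-trans (*-monoˡ-≤-nonNeg c {{nonNegative 0≤c}} (proj₂ (bit-range u-bit)))
                                        (≤-reflexive (*-identityʳ c))

    conv-product-one : ∀ {a b z} → (∀ s → S s → IsBit (s b)) → (∀ s → S s → s z ≡ s a * s b) →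
                       ∀ {y} → conv S y → y b ≡ 1ℚ → y z ≡ y a
    conv-product-one {a} {b} {z} bits product (k , c , v , v∈S , 0≤c , Σc≡1 , y≈) yb≡1 = begin
      _                          ≡⟨ y≈ z ⟩
      sumℚ k (λ t → c t * v t z) ≡⟨ sumℚ-cong k weighted≡ ⟩
      sumℚ k (λ t → c t * v t a) ≡⟨ y≈ a ⟨
      _                          ∎
      where
      open ≡-Reasoning
      Σshift≡0 : sumℚ k (λ t → c t * (v t b - 1ℚ)) ≡ sumℚ k (λ _ → 0ℚ)
      Σshift≡0 = begin
        sumℚ k (λ t → c t * (v t b - 1ℚ)) ≡⟨ sumℚ-weights-+ k Σc≡1 (λ t → v t b) (- 1ℚ) ⟩
        sumℚ k (λ t → c t * v t b) - 1ℚ   ≡⟨ cong (_- 1ℚ) (trans (sym (y≈ b)) yb≡1) ⟩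
        1ℚ - 1ℚ                           ≡⟨ sumℚ-0 k ⟨
        sumℚ k (λ _ → 0ℚ)                 ∎
      shift≡0 : ∀ t → c t * (v t b - 1ℚ) ≡ 0ℚ
      shift≡0 = sumℚ-mono-≤-≡⇒≡ k (λ t → c*[bit-1]≤0 (0≤c t) (bits _ (v∈S t))) Σshift≡0
      weighted≡ : ∀ t → c t * v t z ≡ c t * v t a
      weighted≡ t = trans (cong (c t *_) (product _ (v∈S t)))
                          (c*[u-1]≡0⇒c*[w*u]≡c*w (c t) (v t a) (bits _ (v∈S t)) (shift≡0 t))

  conv-map : ∀ {I J : Set} {S : Point I → Set} {S′ : Point J → Set} {h : Point I → Point J} →
             IsAffineMap h → (∀ {x x′} → x ≈ₚ x′ → h x ≈ₚ h x′) → (∀ s → S s → S′ (h s)) →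
             ∀ {x} → conv S x → conv S′ (h x)
  conv-map {h = h} h-aff h-cong h-maps (k , c , p , p∈S , 0≤c , Σc≡1 , x≈) =
    k , c , h ∘ p , (λ t → h-maps _ (p∈S t)) , 0≤c , Σc≡1 ,
    (λ e → trans (h-cong x≈ e) (h-aff k c p Σc≡1 e))

  module _ {I J : Set} where

    restrict-isAffineMap : (σ : I → J) → IsAffineMap (λ (y : Point J) → y ∘ σ)
    restrict-isAffineMap σ k c p Σc≡1 e = refl

    extendByOne : (J → Maybe I) → Point I → Point J
    extendByOne ρ x e = maybe′ x 1ℚ (ρ e)

    extendByOne-isAffineMap : (ρ : J → Maybe I) → IsAffineMap (extendByOne ρ)
    extendByOne-isAffineMap ρ k c p Σc≡1 e with ρ e
    ... | just i  = refl
    ... | nothing = sym (trans (sumℚ-cong k (λ t → *-identityʳ (c t))) Σc≡1)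

    extendByOne-cong : (ρ : J → Maybe I) → ∀ {x x′} → x ≈ₚ x′ →
                       extendByOne ρ x ≈ₚ extendByOne ρ x′
    extendByOne-cong ρ x≈x′ e with ρ e
    ... | just i  = x≈x′ i
    ... | nothing = refl

    extendByOne-isBit : (ρ : J → Maybe I) → ∀ {x} → (∀ i → IsBit (x i)) →
                        ∀ e → IsBit (extendByOne ρ x e)
    extendByOne-isBit ρ x-bits e with ρ e
    ... | just i  = x-bits i
    ... | nothing = inj₂ refl

open ConvexCombinations

module Doubling where

  open import Data.Nat using (_≤_; _<_; _*_; ⌊_/2⌋; z≤n; s≤s; z<s; s<s)
  open import Data.Nat.Properties using (<-irrefl; <-asym; <-trans; n<1+n; *-suc; suc-injective)

  -- 2 * h by a recursion on h, so that the view Halving below needs no arithmetic lemmas.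
  double : ℕ → ℕ
  double zero    = zero
  double (suc h) = suc (suc (double h))

  data Halving : ℕ → Set where
    even : ∀ h → Halving (double h)
    odd  : ∀ h → Halving (suc (double h))

  halving : ∀ a → Halving a
  halving zero          = even zero
  halving (suc zero)    = odd zero
  halving (suc (suc a)) with halving a
  ... | even h = even (suc h)
  ... | odd h  = odd (suc h)

  ⌊double/2⌋ : ∀ h → ⌊ double h /2⌋ ≡ h
  ⌊double/2⌋ zero    = refl
  ⌊double/2⌋ (suc h) = cong suc (⌊double/2⌋ h)

  ⌊1+double/2⌋ : ∀ h → ⌊ suc (double h) /2⌋ ≡ h
  ⌊1+double/2⌋ zero    = refl
  ⌊1+double/2⌋ (suc h) = cong suc (⌊1+double/2⌋ h)

  double≡2* : ∀ h → double h ≡ 2 * h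
  double≡2* zero    = refl
  double≡2* (suc h) = trans (cong (suc ∘ suc) (double≡2* h)) (sym (*-suc 2 h))

  double-mono-≤ : ∀ {h h′} → h ≤ h′ → double h ≤ double h′
  double-mono-≤ z≤n       = z≤n
  double-mono-≤ (s≤s h≤h′) = s≤s (s≤s (double-mono-≤ h≤h′))

  double-cancel-≤ : ∀ {h h′} → double h ≤ double h′ → h ≤ h′
  double-cancel-≤ {zero}            _                 = z≤n
  double-cancel-≤ {suc h} {suc h′} (s≤s (s≤s 2h≤2h′)) = s≤s (double-cancel-≤ 2h≤2h′)

  double-cancel-< : ∀ {h h′} → double h < double h′ → h < h′
  double-cancel-< {zero}  {suc h′} _                  = z<s
  double-cancel-< {suc h} {suc h′} (s<s (s<s 2h<2h′)) = s<s (double-cancel-< 2h<2h′)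

  1+double≢double : ∀ h h′ → suc (double h) ≢ double h′
  1+double≢double _       zero     ()
  1+double≢double zero    (suc h′) ()
  1+double≢double (suc h) (suc h′) eq = 1+double≢double h h′ (suc-injective (suc-injective eq))

  <double⇒⌊/2⌋< : ∀ {a n} → a < double n → ⌊ a /2⌋ < n
  <double⇒⌊/2⌋< {a} a<2n with halving a
  ... | even h rewrite ⌊double/2⌋ h   = double-cancel-< a<2n
  ... | odd h  rewrite ⌊1+double/2⌋ h = double-cancel-< (<-trans (n<1+n _) a<2n)

  same-⌊/2⌋⇒consecutive : ∀ {a b} → a < b → ⌊ a /2⌋ ≡ ⌊ b /2⌋ →
                            (a ≡ double ⌊ a /2⌋) × (b ≡ suc (double ⌊ a /2⌋))
  same-⌊/2⌋⇒consecutive {a} {b} a<b same with halving a | halving b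
  ... | even h | even h′ with refl ← trans (sym (⌊double/2⌋ h)) (trans same (⌊double/2⌋ h′)) =
    ⊥-elim (<-irrefl refl a<b)
  ... | even h | odd h′ with refl ← trans (sym (⌊double/2⌋ h)) (trans same (⌊1+double/2⌋ h′)) =
    cong double (sym (⌊double/2⌋ h)) , cong (suc ∘ double) (sym (⌊double/2⌋ h))
  ... | odd h | even h′ with refl ← trans (sym (⌊1+double/2⌋ h)) (trans same (⌊double/2⌋ h′)) =
    ⊥-elim (<-asym a<b (n<1+n _))
  ... | odd h | odd h′ with refl ← trans (sym (⌊1+double/2⌋ h)) (trans same (⌊1+double/2⌋ h′)) =
    ⊥-elim (<-irrefl refl a<b)

open Doubling

module Blocks (n : ℕ) where

  open import Data.Nat using (_≤_; _<_; _*_; ⌊_/2⌋; s≤s⁻¹)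
  open import Data.Nat.Properties using (<-trans; <⇒≱; <ᵇ⇒<; n<1+n)
  open import Data.Fin.Properties using (toℕ-fromℕ<; toℕ-injective; toℕ<n)

  private
    1+double<2* : ∀ {h} → h < n → suc (double h) < 2 * n
    1+double<2* {h} h<n = subst (suc (double h) <_) (double≡2* n) (double-mono-≤ h<n)

  lower upper : Fin n → Fin (2 * n)
  lower i = fromℕ< (<-trans (n<1+n _) (1+double<2* (toℕ<n i)))
  upper i = fromℕ< (1+double<2* (toℕ<n i))

  block : Fin (2 * n) → Fin n
  block a = fromℕ< (<double⇒⌊/2⌋< (subst (toℕ a <_) (sym (double≡2* n)) (toℕ<n a)))

  toℕ-lower : ∀ i → toℕ (lower i) ≡ double (toℕ i)
  toℕ-lower i = toℕ-fromℕ< _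

  toℕ-upper : ∀ i → toℕ (upper i) ≡ suc (double (toℕ i))
  toℕ-upper i = toℕ-fromℕ< _

  toℕ-block : ∀ a → toℕ (block a) ≡ ⌊ toℕ a /2⌋
  toℕ-block a = toℕ-fromℕ< _

  block-lower : ∀ i → block (lower i) ≡ i
  block-lower i = toℕ-injective (trans (toℕ-block _) (trans (cong ⌊_/2⌋ (toℕ-lower i)) (⌊double/2⌋ _)))

  block-upper : ∀ i → block (upper i) ≡ i
  block-upper i = toℕ-injective (trans (toℕ-block _) (trans (cong ⌊_/2⌋ (toℕ-upper i)) (⌊1+double/2⌋ _)))

  lower<upper : ∀ i → toℕ (lower i) < toℕ (upper i)
  lower<upper i = subst₂ _<_ (sym (toℕ-lower i)) (sym (toℕ-upper i)) (n<1+n _)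

  lower-mono-< : ∀ {i j} → i Fin.< j → toℕ (lower i) < toℕ (lower j)
  lower-mono-< {i} {j} i<j =
    subst₂ _<_ (sym (toℕ-lower i)) (sym (toℕ-lower j)) (<-trans (n<1+n _) (double-mono-≤ i<j))

  lower-cancel-≤ : ∀ {i j} → toℕ (lower i) ≤ toℕ (lower j) → i Fin.≤ j
  lower-cancel-≤ {i} {j} le = double-cancel-≤ (subst₂ _≤_ (toℕ-lower i) (toℕ-lower j) le)

  lower-injective : ∀ {i j} → lower i ≡ lower j → i ≡ j
  lower-injective {i} {j} eq = trans (sym (block-lower i)) (trans (cong block eq) (block-lower j))

  lower-upper-sameBlock : ∀ i → block (lower i) ≡ block (upper i)
  lower-upper-sameBlock i = trans (block-lower i) (sym (block-upper i))

  upper≢lower : ∀ i j → upper i ≢ lower j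
  upper≢lower i j eq = 1+double≢double _ _ (trans (sym (toℕ-upper i)) (trans (cong toℕ eq) (toℕ-lower j)))

  ¬lower<x<upper : ∀ i {x} → toℕ (lower i) < x → x < toℕ (upper i) → ⊥
  ¬lower<x<upper i lower<x x<upper rewrite toℕ-lower i | toℕ-upper i = <⇒≱ lower<x (s≤s⁻¹ x<upper)

  data PairView (a b : Fin (2 * n)) : Set where
    inBlock : ∀ i → a ≡ lower i → b ≡ upper i → PairView a b
    across  : block a ≢ block b → PairView a b

  pairView : ∀ a b → T (toℕ a <ᵇ toℕ b) → PairView a b
  pairView a b a<b with block a ≟ block b
  ... | no  blocks≢ = across blocks≢
  ... | yes blocks≡ = inBlock (block a)
    (toℕ-injective (trans (proj₁ consecutive) (sym (trans (toℕ-lower _) (cong double (toℕ-block a))))))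
    (toℕ-injective (trans (proj₂ consecutive) (sym (trans (toℕ-upper _) (cong (suc ∘ double) (toℕ-block a))))))
    where
    consecutive : (toℕ a ≡ double ⌊ toℕ a /2⌋) × (toℕ b ≡ suc (double ⌊ toℕ a /2⌋))
    consecutive = same-⌊/2⌋⇒consecutive (<ᵇ⇒< _ _ a<b)
      (trans (sym (toℕ-block a)) (trans (cong toℕ blocks≡) (toℕ-block b)))


module QLOPIndices where

  open import Data.Nat using (_≤_; _<_)
  open import Data.Nat.Properties using (<-irrefl; <⇒≤; ≤-reflexive; <ᵇ⇒<; <⇒<ᵇ; ≡ᵇ⇒≡)

  lex-cases : ∀ a b c d → T ((a <ᵇ c) ∨ ((a ≡ᵇ c) ∧ (b <ᵇ d))) → a < c ⊎ (a ≡ c × b < d)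
  lex-cases a b c d lex with Equivalence.to (T-∨ {a <ᵇ c}) lex
  ... | inj₁ a<c  = inj₁ (<ᵇ⇒< a c a<c)
  ... | inj₂ rest with Equivalence.to (T-∧ {a ≡ᵇ c}) rest
  ...   | a≡c , b<d = inj₂ (≡ᵇ⇒≡ a c a≡c , <ᵇ⇒< b d b<d)

  module _ {m : ℕ} where

    ≺ᵇ⇒≤ : (A B : YIdx m) → T (A ≺ᵇ B) → toℕ (proj₁ A) ≤ toℕ (proj₁ B)
    ≺ᵇ⇒≤ (a , b , _) (c , d , _) A≺B with lex-cases (toℕ a) (toℕ b) (toℕ c) (toℕ d) A≺B
    ... | inj₁ a<c       = <⇒≤ a<c
    ... | inj₂ (a≡c , _) = ≤-reflexive a≡c

    <⇒≺ᵇ : (A B : YIdx m) → toℕ (proj₁ A) < toℕ (proj₁ B) → T (A ≺ᵇ B)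
    <⇒≺ᵇ (a , _ , _) (c , _ , _) a<c = Equivalence.from (T-∨ {toℕ a <ᵇ toℕ c}) (inj₁ (<⇒<ᵇ a<c))

    ≺ᵇ-irrefl : ∀ a b p q → ¬ T (_≺ᵇ_ {m} (a , b , p) (a , b , q))
    ≺ᵇ-irrefl a b p q A≺A with lex-cases (toℕ a) (toℕ b) (toℕ a) (toℕ b) A≺A
    ... | inj₁ a<a       = <-irrefl refl a<a
    ... | inj₂ (_ , b<b) = <-irrefl refl b<b

    yCoord-irrelevant : ∀ {a b : Fin m} {p p′} →
                        _≡_ {A = QLOPIdx m} (inj₁ (a , b , p)) (inj₁ (a , b , p′))
    yCoord-irrelevant {p = p} {p′} = cong (λ p → inj₁ (_ , _ , p)) (T-irrelevant p p′)

    zCoord-irrelevant : ∀ {a b c d : Fin m} {p p′ q q′ s s′} →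
                        _≡_ {A = QLOPIdx m} (inj₂ ((a , b , p) , (c , d , q) , s))
                                            (inj₂ ((a , b , p′) , (c , d , q′) , s′))
    zCoord-irrelevant {p = p} {p′} {q} {q′} {s} {s′} with T-irrelevant p p′ | T-irrelevant q q′
    ... | refl | refl = cong (λ s → inj₂ (_ , _ , s)) (T-irrelevant s s′)

    QLOPVert-isBit : ∀ e v → QLOPVert m v → IsBit (v e)
    QLOPVert-isBit e v (bits , _) = bits e

open QLOPIndices

module Embedding (n : ℕ) where

  open import Data.Fin.Properties using (≤∧≢⇒<)
  import Data.Nat as ℕ
  open import Data.Nat.Properties using (≤-refl; <-irrefl; <ᵇ⇒<; <⇒<ᵇ; ≤ᵇ⇒≤; ≤⇒≤ᵇ)
  open import Data.Rational using (1ℚ; _+_; _*_; _-_)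
  open import Data.Rational.Properties using (*-identityˡ; *-identityʳ)
  open import Data.Rational.Solver using (module +-*-Solver)
  open +-*-Solver

  open Blocks n

  N : ℕ
  N = 2 ℕ.* n

  diag : Fin n → BQPIdx n
  diag i = i , i , ≤⇒≤ᵇ (≤-refl {toℕ i})

  blockPair : Fin n → YIdx N
  blockPair i = lower i , upper i , <⇒<ᵇ (lower<upper i)

  toQLOPIdx : BQPIdx n → QLOPIdx N
  toQLOPIdx (i , j , i≤j) with i ≟ j
  ... | yes _  = inj₁ (blockPair i)
  ... | no i≢j = inj₂ (blockPair i , blockPair j , <⇒≺ᵇ (blockPair i) (blockPair j) (lower-mono-< i<j))
    where
    i<j : i Fin.< j
    i<j = ≤∧≢⇒< (≤ᵇ⇒≤ _ _ i≤j) i≢j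

  toQLOPIdx-diag : ∀ i r p → toQLOPIdx (i , i , r) ≡ inj₁ (lower i , upper i , p)
  toQLOPIdx-diag i r p with i ≟ i
  ... | yes _  = yCoord-irrelevant
  ... | no i≢i = ⊥-elim (i≢i refl)

  toQLOPIdx-offdiag : ∀ {i j} r → i ≢ j → ∀ p q s →
                      toQLOPIdx (i , j , r) ≡ inj₂ ((lower i , upper i , p) , (lower j , upper j , q) , s)
  toQLOPIdx-offdiag {i} {j} r i≢j p q s with i ≟ j
  ... | yes i≡j = ⊥-elim (i≢j i≡j)
  ... | no _    = zCoord-irrelevant

  yIndex : ∀ {a b} → PairView a b → Maybe (BQPIdx n)
  yIndex (inBlock i _ _) = just (diag i)
  yIndex (across _)      = nothing

  zIndex : ∀ {a b c d} → PairView a b → PairView c d → toℕ a ℕ.≤ toℕ c → Maybe (BQPIdx n)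
  zIndex (inBlock i a≡ _) (inBlock j c≡ _) a≤c =
    just (i , j , ≤⇒≤ᵇ (lower-cancel-≤ (subst₂ ℕ._≤_ (cong toℕ a≡) (cong toℕ c≡) a≤c)))
  zIndex (inBlock i _ _)  (across _)       _   = just (diag i)
  zIndex (across _)       (inBlock j _ _)  _   = just (diag j)
  zIndex (across _)       (across _)       _   = nothing

  fromQLOPIdx : QLOPIdx N → Maybe (BQPIdx n)
  fromQLOPIdx (inj₁ (a , b , a<b)) = yIndex (pairView a b a<b)
  fromQLOPIdx (inj₂ (A@(a , b , a<b) , B@(c , d , c<d) , A≺B)) =
    zIndex (pairView a b a<b) (pairView c d c<d) (≺ᵇ⇒≤ A B A≺B)

  embed : Point (BQPIdx n) → Point (QLOPIdx N)
  embed = extendByOne fromQLOPIdx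

  fromQLOPIdx-blockPair : ∀ i p r → fromQLOPIdx (inj₁ (lower i , upper i , p)) ≡ just (i , i , r)
  fromQLOPIdx-blockPair i p r with pairView (lower i) (upper i) p
  ... | inBlock i′ eᵢ _ with refl ← lower-injective eᵢ = cong (λ r → just (i , i , r)) (T-irrelevant _ r)
  ... | across ≢ = ⊥-elim (≢ (lower-upper-sameBlock i))

  fromQLOPIdx-blockPairs : ∀ {i j} p q s r →
    fromQLOPIdx (inj₂ ((lower i , upper i , p) , (lower j , upper j , q) , s)) ≡ just (i , j , r)
  fromQLOPIdx-blockPairs {i} {j} p q s r with pairView (lower i) (upper i) p | pairView (lower j) (upper j) q
  ... | inBlock i′ eᵢ _ | inBlock j′ eⱼ _ with refl ← lower-injective eᵢ | refl ← lower-injective eⱼ =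
    cong (λ r → just (i , j , r)) (T-irrelevant _ r)
  ... | across ≢      | _        = ⊥-elim (≢ (lower-upper-sameBlock i))
  ... | inBlock _ _ _ | across ≢ = ⊥-elim (≢ (lower-upper-sameBlock j))

  fromQLOPIdx∘toQLOPIdx : ∀ s → fromQLOPIdx (toQLOPIdx s) ≡ just s
  fromQLOPIdx∘toQLOPIdx (i , j , r) with i ≟ j
  ... | yes refl = fromQLOPIdx-blockPair i _ r
  ... | no _     = fromQLOPIdx-blockPairs _ _ _ r

  embed-toQLOPIdx : ∀ x s → embed x (toQLOPIdx s) ≡ x s
  embed-toQLOPIdx x s = cong (maybe′ x 1ℚ) (fromQLOPIdx∘toQLOPIdx s)

  embed-injective : ∀ x x′ → aff (BQP n) x → aff (BQP n) x′ → embed x ≈ₚ embed x′ → x ≈ₚ x′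
  embed-injective x x′ _ _ embed≈ s =
    trans (sym (embed-toQLOPIdx x s)) (trans (embed≈ (toQLOPIdx s)) (embed-toQLOPIdx x′ s))

  BQPVert-product : ∀ {x} → BQPVert n x → ∀ i j r → x (i , j , r) ≡ x (diag i) * x (diag j)
  BQPVert-product {x} (bits , product) i j r with i ≟ j
  ... | yes refl = trans (cong (λ r → x (i , i , r)) (T-irrelevant r _)) (bit-idem (bits (diag i)))
  ... | no i≢j   = product i j (<⇒<ᵇ (≤∧≢⇒< (≤ᵇ⇒≤ _ _ r) i≢j)) r _ _

  embed-triangle : ∀ {x} → (∀ s → IsBit (x s)) → ∀ a b c p q r →
    IsBit ((embed x (inj₁ (a , b , p)) + embed x (inj₁ (b , c , q))) - embed x (inj₁ (a , c , r)))
  embed-triangle {x} bits a b c p q r with pairView a b p | pairView b c q | pairView a c r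
  ... | _ | _ | inBlock i refl refl = ⊥-elim (¬lower<x<upper i (<ᵇ⇒< _ _ p) (<ᵇ⇒< _ _ q))
  ... | inBlock i _ b≡upper | inBlock j b≡lower _ | across _ =
    ⊥-elim (upper≢lower i j (trans (sym b≡upper) b≡lower))
  ... | inBlock i _ _ | across _ | across _ =
    subst IsBit (solve 1 (λ u → u := (u :+ con 1ℚ) :- con 1ℚ) refl (x (diag i))) (bits (diag i))
  ... | across _ | inBlock j _ _ | across _ =
    subst IsBit (solve 1 (λ u → u := (con 1ℚ :+ u) :- con 1ℚ) refl (x (diag j))) (bits (diag j))
  ... | across _ | across _ | across _ = inj₂ refl

  embed-product : ∀ {x} → BQPVert n x → ∀ A B s →
                  embed x (inj₂ (A , B , s)) ≡ embed x (inj₁ A) * embed x (inj₁ B)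
  embed-product x-vertex (a , b , p) (c , d , q) s with pairView a b p | pairView c d q
  ... | inBlock i _ _ | inBlock j _ _ = BQPVert-product x-vertex i j _
  ... | inBlock i _ _ | across _      = sym (*-identityʳ _)
  ... | across _      | inBlock j _ _ = sym (*-identityˡ _)
  ... | across _      | across _      = refl

  embed-isVertex : ∀ {x} → BQPVert n x → QLOPVert N (embed x)
  embed-isVertex x-vertex@(bits , _) =
    extendByOne-isBit fromQLOPIdx bits ,
    (λ a b c p q r → bit-range (embed-triangle bits a b c p q r)) ,
    embed-product x-vertex

  restrict-isVertex : ∀ {y} → QLOPVert N y → BQPVert n (y ∘ toQLOPIdx)
  restrict-isVertex {y} (bits , _ , product) = (λ s → bits (toQLOPIdx s)) , restrict-product
    where
    restrict-product : ∀ i j → T (toℕ i <ᵇ toℕ j) → ∀ r rᵢ rⱼ →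
      y (toQLOPIdx (i , j , r)) ≡ y (toQLOPIdx (i , i , rᵢ)) * y (toQLOPIdx (j , j , rⱼ))
    restrict-product i j i<j r rᵢ rⱼ = begin
      y (toQLOPIdx (i , j , r))
        ≡⟨ cong y (toQLOPIdx-offdiag r i≢j _ _ A≺B) ⟩
      y (inj₂ (blockPair i , blockPair j , A≺B))
        ≡⟨ product (blockPair i) (blockPair j) A≺B ⟩
      y (inj₁ (blockPair i)) * y (inj₁ (blockPair j))
        ≡⟨ cong₂ _*_ (cong y (toQLOPIdx-diag i rᵢ _)) (cong y (toQLOPIdx-diag j rⱼ _)) ⟨
      y (toQLOPIdx (i , i , rᵢ)) * y (toQLOPIdx (j , j , rⱼ)) ∎
      where
      open ≡-Reasoning
      A≺B : T (blockPair i ≺ᵇ blockPair j)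
      A≺B = <⇒≺ᵇ (blockPair i) (blockPair j) (lower-mono-< (<ᵇ⇒< _ _ i<j))
      i≢j : i ≢ j
      i≢j refl = <-irrefl refl (<ᵇ⇒< (toℕ i) _ i<j)

module BlockOrderFace (n : ℕ) where

  open import Data.Rational using (ℚ; 0ℚ; 1ℚ; _-_; -_; _≤_)
  open import Data.Rational.Properties using (≤-refl; +-monoˡ-≤; *-comm; +-0-group)
  open import Algebra.Properties.Group +-0-group using (x∙y⁻¹≈ε⇒x≈y)

  open Blocks n
  open Embedding n

  acrossSlack : Point (QLOPIdx N) → YIdx N → ℚ
  acrossSlack y A = maybe′ (λ _ → 0ℚ) (y (inj₁ A) - 1ℚ) (fromQLOPIdx (inj₁ A))

  slack : Point (QLOPIdx N) → Fin N → Fin N → ℚ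
  slack y a b with T? (toℕ a <ᵇ toℕ b)
  ... | yes a<b = acrossSlack y (a , b , a<b)
  ... | no  _   = 0ℚ

  faceFunctional : Point (QLOPIdx N) → ℚ
  faceFunctional y = sumℚ N (λ a → sumℚ N (slack y a))

  acrossSlack-isAffineFunctional : ∀ A → IsAffineFunctional (λ y → acrossSlack y A)
  acrossSlack-isAffineFunctional A with fromQLOPIdx (inj₁ A)
  ... | just _  = 0-isAffineFunctional
  ... | nothing = coordinate-+-isAffineFunctional (inj₁ A) (- 1ℚ)

  slack-isAffineFunctional : ∀ a b → IsAffineFunctional (λ y → slack y a b)
  slack-isAffineFunctional a b with T? (toℕ a <ᵇ toℕ b)
  ... | yes a<b = acrossSlack-isAffineFunctional (a , b , a<b)
  ... | no  _   = 0-isAffineFunctional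

  faceFunctional-isAffineFunctional : IsAffineFunctional faceFunctional
  faceFunctional-isAffineFunctional =
    sumℚ-isAffineFunctional N {λ a y → sumℚ N (slack y a)} λ a →
      sumℚ-isAffineFunctional N {λ b y → slack y a b} (slack-isAffineFunctional a)

  slack-embed : ∀ x a b → slack (embed x) a b ≡ 0ℚ
  slack-embed x a b with T? (toℕ a <ᵇ toℕ b)
  ... | no  _   = refl
  ... | yes a<b with fromQLOPIdx (inj₁ (a , b , a<b))
  ...   | just _  = refl
  ...   | nothing = refl

  faceFunctional-embed : ∀ x → faceFunctional (embed x) ≡ 0ℚ
  faceFunctional-embed x =
    trans (sumℚ-cong N (λ a → trans (sumℚ-cong N (slack-embed x a)) (sumℚ-0 N))) (sumℚ-0 N)

  slack-nonpos : ∀ {y} → QLOP N y → ∀ a b → slack y a b ≤ 0ℚ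
  slack-nonpos y∈QLOP a b with T? (toℕ a <ᵇ toℕ b)
  ... | no  _   = ≤-refl
  ... | yes a<b with fromQLOPIdx (inj₁ (a , b , a<b))
  ...   | just _  = ≤-refl
  ...   | nothing = +-monoˡ-≤ (- 1ℚ) (conv-coordinate-≤1 _ (QLOPVert-isBit _) y∈QLOP)

  faceFunctional-valid : IsValid (QLOP N) faceFunctional
  faceFunctional-valid y y∈QLOP = sumℚ-nonpos N (λ a → sumℚ-nonpos N (slack-nonpos y∈QLOP a))

  fromQLOPIdx-across : ∀ {a b} → block a ≢ block b → ∀ p → fromQLOPIdx (inj₁ (a , b , p)) ≡ nothing
  fromQLOPIdx-across {a} {b} blocks≢ p with pairView a b p
  ... | inBlock i refl refl = ⊥-elim (blocks≢ (lower-upper-sameBlock i))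
  ... | across _            = refl

  slack-at : ∀ y a b p → slack y a b ≡ acrossSlack y (a , b , p)
  slack-at y a b p with T? (toℕ a <ᵇ toℕ b)
  ... | yes a<b = cong (λ p → acrossSlack y (a , b , p)) (T-irrelevant a<b p)
  ... | no  a≮b = ⊥-elim (a≮b p)

  module Face {y} (y∈QLOP : QLOP N y) (y∈face : faceFunctional y ≡ 0ℚ) where

    slack≡0 : ∀ a b → slack y a b ≡ 0ℚ
    slack≡0 a = sumℚ-nonpos-≡0 N (slack-nonpos y∈QLOP a)
      (sumℚ-nonpos-≡0 N (λ a → sumℚ-nonpos N (slack-nonpos y∈QLOP a)) y∈face a)

    across≡1 : ∀ {a b} → block a ≢ block b → ∀ p → y (inj₁ (a , b , p)) ≡ 1ℚ
    across≡1 {a} {b} blocks≢ p = x∙y⁻¹≈ε⇒x≈y _ _ (begin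
      y (inj₁ (a , b , p)) - 1ℚ
        ≡⟨ cong (maybe′ (λ _ → 0ℚ) (y (inj₁ (a , b , p)) - 1ℚ)) (fromQLOPIdx-across blocks≢ p) ⟨
      acrossSlack y (a , b , p)
        ≡⟨ slack-at y a b p ⟨
      slack y a b
        ≡⟨ slack≡0 a b ⟩
      0ℚ ∎)
      where open ≡-Reasoning

    z≡y-left : ∀ A B s → y (inj₁ B) ≡ 1ℚ → y (inj₂ (A , B , s)) ≡ y (inj₁ A)
    z≡y-left A B s =
      conv-product-one {a = inj₁ A} (QLOPVert-isBit _) (λ v (_ , _ , product) → product A B s) y∈QLOP

    z≡y-right : ∀ A B s → y (inj₁ A) ≡ 1ℚ → y (inj₂ (A , B , s)) ≡ y (inj₁ B)
    z≡y-right A B s = conv-product-one {a = inj₁ B} (QLOPVert-isBit _)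
      (λ v (_ , _ , product) → trans (product A B s) (*-comm (v (inj₁ A)) (v (inj₁ B)))) y∈QLOP

    embed-restrict : embed (y ∘ toQLOPIdx) ≈ₚ y
    embed-restrict (inj₁ (a , b , p)) with pairView a b p
    ... | inBlock i refl refl = cong y (toQLOPIdx-diag i _ p)
    ... | across blocks≢      = sym (across≡1 blocks≢ p)
    embed-restrict (inj₂ ((a , b , p) , (c , d , q) , s)) with pairView a b p | pairView c d q
    ... | inBlock i refl refl | inBlock j refl refl =
      cong y (toQLOPIdx-offdiag _ (λ { refl → ≺ᵇ-irrefl (lower i) (upper i) p q s }) p q s)
    ... | inBlock i refl refl | across blocks≢ =
      trans (cong y (toQLOPIdx-diag i _ p)) (sym (z≡y-left _ _ s (across≡1 blocks≢ q)))
    ... | across blocks≢ | inBlock j refl refl =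
      trans (cong y (toQLOPIdx-diag j _ q)) (sym (z≡y-right _ _ s (across≡1 blocks≢ p)))
    ... | across blocks≢ | across blocks≢′ =
      sym (trans (z≡y-left _ _ s (across≡1 blocks≢′ q)) (across≡1 blocks≢ p))

  embed-face : ∀ x → BQP n x → faceBy (QLOP N) faceFunctional (embed x)
  embed-face x x∈BQP =
    conv-map {S = BQPVert n} {S′ = QLOPVert N}
             (extendByOne-isAffineMap fromQLOPIdx) (extendByOne-cong fromQLOPIdx) (λ _ → embed-isVertex) x∈BQP ,
    faceFunctional-embed x

  face-restrict : ∀ y → faceBy (QLOP N) faceFunctional y →
                  Σ (Point (BQPIdx n)) λ x → BQP n x × (embed x ≈ₚ y)
  face-restrict y (y∈QLOP , y∈face) =
    y ∘ toQLOPIdx ,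
    conv-map {S = QLOPVert N} {S′ = BQPVert n}
             (restrict-isAffineMap toQLOPIdx) (λ y≈ e → y≈ (toQLOPIdx e)) (λ _ → restrict-isVertex) y∈QLOP ,
    Face.embed-restrict y∈QLOP y∈face

open import Data.Nat using (_≤_; _*_)

-- The construction works for every n.
theorem9 : (n : ℕ) → 1 ≤ n → BQP n ≤A QLOP (2 * n)
theorem9 n _ =
  inj₂ (faceFunctional , faceFunctional-isAffineFunctional , faceFunctional-valid ,
        embed , extendByOne-isAffineMap fromQLOPIdx , embed-injective , embed-face , face-restrict)
  where
  open Embedding n
  open BlockOrderFace n
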